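{- (a) $\mathit{Num}(\ast)$ is solved exactly by the $0$-numerals: for a term $a$ without unknowns, $\models\mathit{Num}(a)$ iff $a=S^m(0)$ for some $m\ge0$. (b) $\widetilde{\mathit{Num}}(\ast)$ is solved exactly by the $\tilde 0$-numerals: for a term $a$ without unknowns, $\models\widetilde{\mathit{Num}}(a)$ iff $a=S^m(\tilde 0)$ for some $m\ge0$.
   Context: First-order predicate calculus with identity $\doteq$, over a language with countably many variables and countably infinitely many function and predicate symbols of every arity; terms are variable-free; $\models\theta$ means $\theta$ is true in every structure. Unknowns are distinguished constants; a term $a$ without unknowns solves $\phi(\ast)$ if $\models\phi(a)$. The language contains distinct constants $0,\tilde0$ (not unknowns) and a unary function symbol $S$; $S^0(t)=t$, $S^{m+1}(t)=S(S^m(t))$. $\mathit{Num}(x)$ is $0\doteq S(0)\to0\doteq x$ and $\widetilde{\mathit{Num}}(x)$ is $\tilde0\doteq S(\tilde0)\to\tilde0\doteq x$. -}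

module Defs where

open import Data.Nat using (ℕ; zero; suc)
open import Data.Bool using (Bool; true; false)
open import Data.Vec using (Vec; []; _∷_)
open import Data.Vec.Relation.Unary.All using (All)
open import Data.Empty using (⊥)
open import Data.Unit using (⊤)
open import Relation.Binary.PropositionalEquality using (_≡_)

-- Countably infinitely many of every
-- arity (`other n k`), plus the distinguished constants 0, 0̃, the unary S,
-- and countably many unknowns (distinguished constants).
data FSym : ℕ → Set where
  𝟘       : FSym 0
  𝟘~      : FSym 0
  S'      : FSym 1
  unknown : ℕ → FSym 0
  other   : (n k : ℕ) → FSym n

PSym : ℕ → Set
PSym n = ℕ

data Term : Set where
  app : ∀ {n} → FSym n → Vec Term n → Term

isUnknown : ∀ {n} → FSym n → Bool
isUnknown (unknown _) = true
isUnknown _           = false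

data NoUnknowns : Term → Set where
  app : ∀ {n} {f : FSym n} {ts : Vec Term n} →
        isUnknown f ≡ false → All NoUnknowns ts → NoUnknowns (app f ts)

zeroT zero~T : Term
zeroT  = app 𝟘 []
zero~T = app 𝟘~ []

S : Term → Term
S t = app S' (t ∷ [])

S^ : ℕ → Term → Term
S^ zero    t = t
S^ (suc m) t = S (S^ m t)

data Formula : Set where
  _≐_  : Term → Term → Formula
  rel  : ∀ {n} → PSym n → Vec Term n → Formula
  ⊥'   : Formula
  _⇒_  : Formula → Formula → Formula

infix 5 _≐_
infixr 4 _⇒_

record Structure : Set₁ where
  field
    Carrier : Set
    fun     : ∀ {n} → FSym n → Vec Carrier n → Carrier
    pred    : ∀ {n} → PSym n → Vec Carrier n → Set

module _ (M : Structure) where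
  open Structure M

  mutual
    eval : Term → Carrier
    eval (app f ts) = fun f (evals ts)

    evals : ∀ {n} → Vec Term n → Vec Carrier n
    evals []       = []
    evals (t ∷ ts) = eval t ∷ evals ts

  _⊨_ : Formula → Set
  _⊨_ (s ≐ t)    = eval s ≡ eval t
  _⊨_ (rel p ts) = pred p (evals ts)
  _⊨_ ⊥'         = ⊥
  _⊨_ (φ ⇒ ψ)    = _⊨_ φ → _⊨_ ψ

Valid : Formula → Set₁
Valid θ = (M : Structure) → M ⊨ θ

Num : Term → Formula
Num x = (zeroT ≐ S zeroT) ⇒ (zeroT ≐ x)

Num~ : Term → Formula
Num~ x = (zero~T ≐ S zero~T) ⇒ (zero~T ≐ x)

module Submission where

-- Both parts are instances of one fact about an arbitrary constant c:
-- a term a satisfies  ⊨ (c ≐ S(c) → c ≐ a)  iff  a = Sᵐ(c) for some m.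
--
-- * If a = Sᵐ(c), then in any structure where c = S(c) holds, iterating
--   that equation gives c = Sᵐ(c)  (`loop-reaches-numerals`).
-- * Conversely, evaluate in the "S-erasing" term structure, whose carrier
--   is the set of terms, where S is the identity and every other symbol is
--   interpreted freely.  There c = S(c) holds, so validity yields
--   (erasure of a) = c, and a term whose S-erasure is the constant c must be
--   a numeral Sᵐ(c)  (`erasure-detects-numerals`).
--
-- Neither direction needs the hypothesis that a is free of unknowns.

open import Defs
open import Data.Nat using (ℕ; zero; suc)
open import Data.Product using (_×_; ∃-syntax; _,_)
open import Data.Vec using (Vec; []; _∷_)
open import Data.Unit using (⊤)
open import Function.Bundles using (_⇔_; mk⇔)
open import Relation.Binary.PropositionalEquality using (_≡_; refl; trans; cong; sym)

const : FSym 0 → Term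
const c = app c []

LoopImplies : FSym 0 → Term → Formula
LoopImplies c x = (const c ≐ S (const c)) ⇒ (const c ≐ x)

loop-reaches-numerals : (M : Structure) (c : FSym 0) (m : ℕ) →
  M ⊨ (const c ≐ S (const c)) → M ⊨ (const c ≐ S^ m (const c))
loop-reaches-numerals M c zero    loop = refl
loop-reaches-numerals M c (suc m) loop =
  trans loop (cong (λ x → Structure.fun M S' (x ∷ [])) (loop-reaches-numerals M c m loop))

Erasing : Structure
Erasing = record { Carrier = Term ; fun = interpret ; pred = λ _ _ → ⊤ }
  where
  interpret : ∀ {n} → FSym n → Vec Term n → Term
  interpret S' (t ∷ []) = t
  interpret g  ts       = app g ts

erasing-fixes-constants : (c : FSym 0) → eval Erasing (const c) ≡ const c
erasing-fixes-constants 𝟘           = refl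
erasing-fixes-constants 𝟘~          = refl
erasing-fixes-constants (unknown k) = refl
erasing-fixes-constants (other 0 k) = refl

erasure-detects-numerals : (c : FSym 0) (a : Term) →
  eval Erasing a ≡ const c → ∃[ m ] a ≡ S^ m (const c)
erasure-detects-numerals c (app S' (t ∷ [])) erased
  with erasure-detects-numerals c t erased
... | m , refl = suc m , refl
erasure-detects-numerals c (app 𝟘           []) refl = zero , refl
erasure-detects-numerals c (app 𝟘~          []) refl = zero , refl
erasure-detects-numerals c (app (unknown k) []) refl = zero , refl
erasure-detects-numerals c (app (other 0 k) []) refl = zero , refl
erasure-detects-numerals c (app (other (suc n) k) (t ∷ ts)) ()

loop-solutions : (c : FSym 0) (a : Term) →
  Valid (LoopImplies c a) ⇔ (∃[ m ] a ≡ S^ m (const c))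
loop-solutions c a = mk⇔ numeral valid
  where
  -- In the erasing structure c = S(c) holds by definition of S.
  numeral : Valid (LoopImplies c a) → ∃[ m ] a ≡ S^ m (const c)
  numeral v = erasure-detects-numerals c a
    (trans (sym (v Erasing refl)) (erasing-fixes-constants c))

  valid : ∃[ m ] a ≡ S^ m (const c) → Valid (LoopImplies c a)
  valid (m , refl) M = loop-reaches-numerals M c m

lemma5p3 : ((a : Term) → NoUnknowns a → (Valid (Num a) ⇔ (∃[ m ] a ≡ S^ m zeroT)))
    × ((a : Term) → NoUnknowns a → (Valid (Num~ a) ⇔ (∃[ m ] a ≡ S^ m zero~T)))
lemma5p3 = (λ a _ → loop-solutions 𝟘 a) , (λ a _ → loop-solutions 𝟘~ a)
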